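{- Let $G$ be a connected $K^3_3$-saturated graph of order $n\geq 6$ with $\delta(G)\geq 2$. Let $N_0\subset V(G)$ be a non-empty vertex set such that $V(G)=\bigcup_{i=0}^{d}N_i$ for some $3\leq d\leq 4$, and suppose there is a vertex $v\in N_0$ that does not belong to the triangle of any subgraph of $G$ isomorphic to $K^2_3$. Then: (i) if $u\in\bigcup_{i=3}^{d}N_i$, then for every $w\in N(u)$, $w$ is adjacent to some vertex of $N(u)\setminus\{w\}$; (ii) if $u\in\bigcup_{i=3}^{d}N_i$ and $d(u)=2$, then $u\in N_3$, $u$ is a type-IV vertex, and $N(u)\subseteq N_2$.
   Context: All graphs are finite and simple; $d(v)$ is the degree, $N(v)$ the neighborhood, $\delta(G)$ the minimum degree. For $v\notin U$, write $v\sim U$ if $v$ is adjacent to some vertex of $U$. Given non-empty $N_0\subset V(G)$, set $N_1=\{x\in V(G): x\sim N_0\}\setminus N_0$ and, for $i\ge2$, $N_i=\{x\in V(G): x\sim N_{i-1}\}\setminus(N_{i-1}\cup N_{i-2})$. The virus $K^s_3$ ($s=2,3$) is the triangle $K_3$ with one pendant vertex attached to each of $s$ distinct triangle vertices; the triangle is its center. A graph $G$ is $K^3_3$-saturated if it contains no subgraph isomorphic to $K^3_3$ but $G+uv$ contains one for every pair of non-adjacent vertices $u,v$; a graph with fewer than $6$ vertices is not $K^3_3$-saturated by convention. A vertex $u$ with $d(u)=2$ and $N(u)=\{u_1,u_2\}$ is a type-IV vertex if $d(u_1)\ge3$, $d(u_2)\ge3$, $u_1u_2\in E(G)$, and there exist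 two distinct vertices $u_1',u_2'\in V(G)\setminus\{u,u_1,u_2\}$ with $u_1u_1',u_2u_2'\in E(G)$. -}

module Defs where

open import Level using (0ℓ)
open import Data.Nat using (ℕ; zero; suc; _≤_; _≥_)
open import Data.Fin using (Fin)
open import Data.Vec using (count; allFin)
open import Data.Product using (Σ; ∃; ∃-syntax; _×_; _,_)
open import Data.Sum using (_⊎_)
open import Relation.Nullary using (¬_)
open import Relation.Binary using (Decidable; Rel)
open import Relation.Binary.PropositionalEquality using (_≡_; _≢_)
open import Relation.Binary.Construct.Closure.ReflexiveTransitive using (Star)

record Graph (n : ℕ) : Set₁ where
  field
    _~_    : Fin n → Fin n → Set
    ~-sym  : ∀ {x y} → x ~ y → y ~ x
    ~-irr  : ∀ {x} → ¬ (x ~ x)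
    _~?_   : Decidable _~_

module _ {n : ℕ} where

  AddEdge : Rel (Fin n) 0ℓ → Fin n → Fin n → Rel (Fin n) 0ℓ
  AddEdge R u v x y = R x y ⊎ ((x ≡ u × y ≡ v) ⊎ (x ≡ v × y ≡ u))

  HasK33 : Rel (Fin n) 0ℓ → Set
  HasK33 R = Σ (Fin n) λ a → Σ (Fin n) λ b → Σ (Fin n) λ c →
             Σ (Fin n) λ a' → Σ (Fin n) λ b' → Σ (Fin n) λ c' →
    (a ≢ b × a ≢ c × a ≢ a' × a ≢ b' × a ≢ c' ×
     b ≢ c × b ≢ a' × b ≢ b' × b ≢ c' ×
     c ≢ a' × c ≢ b' × c ≢ c' ×
     a' ≢ b' × a' ≢ c' × b' ≢ c') ×
    (R a b × R b c × R a c × R a a' × R b b' × R c c')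

  InK23Triangle : Rel (Fin n) 0ℓ → Fin n → Set
  InK23Triangle R v = Σ (Fin n) λ a → Σ (Fin n) λ b → Σ (Fin n) λ c →
             Σ (Fin n) λ a' → Σ (Fin n) λ b' →
    (a ≢ b × a ≢ c × a ≢ a' × a ≢ b' ×
     b ≢ c × b ≢ a' × b ≢ b' ×
     c ≢ a' × c ≢ b' ×
     a' ≢ b') ×
    (R a b × R b c × R a c × R a a' × R b b') ×
    (v ≡ a ⊎ v ≡ b ⊎ v ≡ c)

module _ {n : ℕ} (G : Graph n) where
  open Graph G

  deg : Fin n → ℕ
  deg u = count (u ~?_) (allFin n)

  MinDeg≥ : ℕ → Set
  MinDeg≥ k = ∀ v → deg v ≥ k

  Connected : Set
  Connected = ∀ x y → Star _~_ x y

  -- K^3_3-saturated (graphs with fewer than 6 vertices are not, by convention)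
  K33Saturated : Set
  K33Saturated = 6 ≤ n × ¬ HasK33 _~_ ×
    (∀ u v → u ≢ v → ¬ (u ~ v) → HasK33 (AddEdge _~_ u v))

  Layer : (Fin n → Set) → ℕ → Fin n → Set
  Layer N₀ zero x = N₀ x
  Layer N₀ (suc zero) x = (∃[ y ] (N₀ y × x ~ y)) × ¬ N₀ x
  Layer N₀ (suc (suc i)) x =
    (∃[ y ] (Layer N₀ (suc i) y × x ~ y)) × ¬ Layer N₀ (suc i) x × ¬ Layer N₀ i x

  TypeIV : Fin n → Set
  TypeIV u = deg u ≡ 2 × Σ (Fin n) λ u₁ → Σ (Fin n) λ u₂ →
    u₁ ≢ u₂ × u ~ u₁ × u ~ u₂ × (∀ w → u ~ w → w ≡ u₁ ⊎ w ≡ u₂) ×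
    deg u₁ ≥ 3 × deg u₂ ≥ 3 × u₁ ~ u₂ ×
    Σ (Fin n) λ u₁' → Σ (Fin n) λ u₂' →
      u₁' ≢ u₂' ×
      u₁' ≢ u × u₁' ≢ u₁ × u₁' ≢ u₂ × u₂' ≢ u × u₂' ≢ u₁ × u₂' ≢ u₂ ×
      u₁ ~ u₁' × u₂ ~ u₂'

{-# OPTIONS --safe #-}
-- A vertex u of N_i with i ≥ 3 is at distance at least 3 from v ∈ N₀. By saturation
-- G + uv contains a K³₃; the new edge uv is not in its triangle (u and v have no common
-- neighbour) and is not the pendant edge at v (v lies in no K²₃-triangle), so it is the
-- pendant edge at u: u is the pendant-free vertex of a K²₃ with triangle u p q and pendant
-- edges p p', q q'. As G has no K³₃, N(u) ⊆ {p, q, p', q'}, which gives (i).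
-- If d(u) = 2 then N(u) = {p, q}. Were p also at distance at least 3 from v, p would be the
-- pendant-free vertex of a K²₃ of its own, with u as the pendant at q; K³₃-freeness then
-- makes u, p, q and the rest of that K²₃ a component of G avoiding v. So p, q ∈ N₂,
-- whence u ∈ N₃, and the type-IV conditions are read off the K²₃ at u.
module Submission where

open import Defs
open import Level using (Level)
open import Data.Nat using (ℕ; zero; suc; _+_; _≤_; _≥_; _<_; z≤n; s≤s; _≤?_)
open import Data.Nat.Properties
  using (≤-trans; ≤-antisym; ≤-pred; ≰⇒>; ≤-<-trans; n≤1+n; m≤n⇒m≤1+n; m<n⇒m<1+n; m≤n⇒m<n∨m≡n; module ≤-Reasoning)
open import Data.Fin using (Fin; _≟_)
open import Data.List using (List; []; _∷_)
open import Data.List.Membership.Propositional using (_∈_)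
open import Data.List.Relation.Unary.All using (All; []; _∷_)
open import Data.List.Relation.Unary.All.Properties using (¬Any⇒All¬; All¬⇒¬Any)
open import Data.List.Relation.Unary.Any using (here; there)
open import Data.Vec using (Vec; []; _∷_; count)
open import Data.Vec.Membership.Propositional using () renaming (_∈_ to _∈ᵥ_)
open import Data.Vec.Membership.Propositional.Properties using (∈-allFin⁺)
open import Data.Vec.Relation.Unary.Any using (here; there)
open import Data.Product using (∃-syntax; _×_; _,_; proj₁)
open import Data.Sum using (_⊎_; inj₁; inj₂)
open import Data.Empty using (⊥; ⊥-elim)
open import Function using (id; case_of_)
open import Relation.Nullary using (¬_; yes; no; contradiction)
open import Relation.Unary using (Pred; Decidable; _⊆_; _∩_; ∁)
open import Relation.Unary.Properties using (∅?; _∩?_; ∁?)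
open import Relation.Binary.Definitions using (DecidableEquality)
open import Relation.Binary.PropositionalEquality using (_≡_; _≢_; refl; subst; ≢-sym)
open import Relation.Binary.Construct.Closure.ReflexiveTransitive using (Star; fold)

private variable
  ℓᵃ ℓ ℓ′ : Level
  A : Set ℓᵃ
  m : ℕ

module _ {P : Pred A ℓ} {Q : Pred A ℓ′} (P? : Decidable P) (Q? : Decidable Q) (P⊆Q : P ⊆ Q) where

  count-mono : (xs : Vec A m) → count P? xs ≤ count Q? xs
  count-mono [] = z≤n
  count-mono (x ∷ xs) with P? x | Q? x
  ... | yes _ | yes _  = s≤s (count-mono xs)
  ... | yes px | no ¬qx = contradiction (P⊆Q px) ¬qx
  ... | no _ | yes _   = m≤n⇒m≤1+n (count-mono xs)
  ... | no _ | no _    = count-mono xs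

  count-< : ∀ {x} {xs : Vec A m} → x ∈ᵥ xs → Q x → ¬ P x → count P? xs < count Q? xs
  count-< {x = x} {x ∷ xs} (here refl) qx ¬px with P? x | Q? x
  ... | yes px | _     = contradiction px ¬px
  ... | no _ | yes _   = s≤s (count-mono xs)
  ... | no _ | no ¬qx  = contradiction qx ¬qx
  count-< {xs = y ∷ xs} (there x∈xs) qx ¬px with P? y | Q? y
  ... | yes _ | yes _   = s≤s (count-< x∈xs qx ¬px)
  ... | yes py | no ¬qy = contradiction (P⊆Q py) ¬qy
  ... | no _ | yes _    = m<n⇒m<1+n (count-< x∈xs qx ¬px)
  ... | no _ | no _     = count-< x∈xs qx ¬px

module _ (_≟_ : DecidableEquality A) {P : Pred A ℓ} (P? : Decidable P) where

  3≤count : ∀ {x y z} {xs : Vec A m} → x ∈ᵥ xs → y ∈ᵥ xs → z ∈ᵥ xs → P x → P y → P z →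
            x ≢ y → x ≢ z → y ≢ z → 3 ≤ count P? xs
  3≤count {x = x} {y} {z} {xs} x∈xs y∈xs z∈xs px py pz x≢y x≢z y≢z = begin
    3                     ≤⟨ s≤s (s≤s (s≤s z≤n)) ⟩
    3 + count ∅? xs       ≤⟨ s≤s (s≤s (count-< ∅? P₂? (λ ()) z∈xs ((pz , ≢-sym x≢z) , ≢-sym y≢z) λ ())) ⟩
    2 + count P₂? xs      ≤⟨ s≤s (count-< P₂? P₁? proj₁ y∈xs (py , ≢-sym x≢y) λ (_ , y≢y) → y≢y refl) ⟩
    1 + count P₁? xs      ≤⟨ count-< P₁? P? proj₁ x∈xs px (λ (_ , x≢x) → x≢x refl) ⟩
    count P? xs           ∎
    where
    open ≤-Reasoning
    P₁? : Decidable (P ∩ ∁ (_≡ x))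
    P₁? = P? ∩? ∁? (_≟ x)
    P₂? : Decidable ((P ∩ ∁ (_≡ x)) ∩ ∁ (_≡ y))
    P₂? = P₁? ∩? ∁? (_≟ y)

module GraphFacts {n : ℕ} (G : Graph n) where
  open Graph G
  open import Data.List.Membership.DecPropositional (_≟_ {n}) using (_∈?_)

  private variable
    a b c p q p' q' x y z : Fin n
    xs : List (Fin n)

  ~⇒≢ : x ~ y → x ≢ y
  ~⇒≢ x~y refl = ~-irr x~y

  3≤deg : x ~ a → x ~ b → x ~ c → a ≢ b → a ≢ c → b ≢ c → 3 ≤ deg G x
  3≤deg {x} {a} {b} {c} = 3≤count _≟_ (x ~?_) (∈-allFin⁺ a) (∈-allFin⁺ b) (∈-allFin⁺ c)

  NbhdIn : Fin n → List (Fin n) → Set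
  NbhdIn x xs = ∀ {w} → x ~ w → w ∈ xs

  nbhdIn : (∀ {w} → x ~ w → All (w ≢_) xs → ⊥) → NbhdIn x xs
  nbhdIn {xs = xs} escape {w} x~w with w ∈? xs
  ... | yes w∈xs = w∈xs
  ... | no w∉xs  = ⊥-elim (escape x~w (¬Any⇒All¬ xs w∉xs))

  deg≡2⇒nbhd : deg G x ≡ 2 → x ~ p → x ~ q → p ≢ q → NbhdIn x (p ∷ q ∷ [])
  deg≡2⇒nbhd deg≡2 x~p x~q p≢q = nbhdIn λ { x~w (w≢p ∷ w≢q ∷ []) →
    3≰2 (subst (3 ≤_) deg≡2 (3≤deg x~p x~q x~w p≢q (≢-sym w≢p) (≢-sym w≢q))) }
    where
    3≰2 : ¬ 3 ≤ 2
    3≰2 (s≤s (s≤s ()))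

  Closed : List (Fin n) → Set
  Closed xs = ∀ {x} → x ∈ xs → NbhdIn x xs

  closed-reachable : Closed xs → Star _~_ x y → x ∈ xs → y ∈ xs
  closed-reachable {xs} closed = fold (λ x y → x ∈ xs → y ∈ xs) (λ x~y reach x∈ → reach (closed x∈ x~y)) id

  record Far (x y : Fin n) : Set where
    field
      distinct            : x ≢ y
      nonadjacent         : ¬ x ~ y
      no-common-neighbour : x ~ z → z ~ y → ⊥

  -- The distinctness facts not listed follow from the edges.
  record K23 (x p q p' q' : Fin n) : Set where
    constructor k23
    field
      x~p : x ~ p
      x~q : x ~ q
      p~q : p ~ q
      p~p' : p ~ p'
      q~q' : q ~ q'
      x≢p' : x ≢ p'
      x≢q' : x ≢ q'
      p≢q' : p ≢ q'
      q≢p' : q ≢ p'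
      p'≢q' : p' ≢ q'

  K23-swap : K23 x p q p' q' → K23 x q p q' p'
  K23-swap (k23 x~p x~q p~q p~p' q~q' x≢p' x≢q' p≢q' q≢p' p'≢q') =
    k23 x~q x~p (~-sym p~q) q~q' p~p' x≢q' x≢p' q≢p' p≢q' (≢-sym p'≢q')

  K23⇒InK23Triangle : K23 x p q p' q' → InK23Triangle _~_ x
  K23⇒InK23Triangle (k23 x~p x~q p~q p~p' q~q' x≢p' x≢q' p≢q' q≢p' p'≢q') =
    _ , _ , _ , _ , _ ,
    (~⇒≢ p~q , ≢-sym (~⇒≢ x~p) , ~⇒≢ p~p' , p≢q' , ≢-sym (~⇒≢ x~q) , q≢p' , ~⇒≢ q~q' , x≢p' , x≢q' , p'≢q') ,
    (p~q , ~-sym x~q , ~-sym x~p , p~p' , q~q') ,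
    inj₂ (inj₂ refl)

  K23⇒TypeIV : deg G x ≡ 2 → K23 x p q p' q' → TypeIV G x
  K23⇒TypeIV {x} {p} {q} deg≡2 (k23 x~p x~q p~q p~p' q~q' x≢p' x≢q' p≢q' q≢p' p'≢q') =
    deg≡2 , p , q , p≢q , x~p , x~q , nbhd ,
    3≤deg (~-sym x~p) p~q p~p' x≢q x≢p' q≢p' ,
    3≤deg (~-sym x~q) (~-sym p~q) q~q' x≢p x≢q' p≢q' ,
    p~q , _ , _ , p'≢q' , ≢-sym x≢p' , ≢-sym (~⇒≢ p~p') , ≢-sym q≢p' ,
    ≢-sym x≢q' , ≢-sym p≢q' , ≢-sym (~⇒≢ q~q') , p~p' , q~q'
    where
    p≢q : p ≢ q
    p≢q = ~⇒≢ p~q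
    x≢p : x ≢ p
    x≢p = ~⇒≢ x~p
    x≢q : x ≢ q
    x≢q = ~⇒≢ x~q
    nbhd : ∀ w → x ~ w → w ≡ p ⊎ w ≡ q
    nbhd w x~w with deg≡2⇒nbhd deg≡2 x~p x~q p≢q x~w
    ... | here w≡p = inj₁ w≡p
    ... | there (here w≡q) = inj₂ w≡q

module Layers {n : ℕ} (G : Graph n) (N₀ : Fin n → Set) where
  open Graph G
  open GraphFacts G using (Far)

  private variable
    i j k : ℕ
    u v x y : Fin n

  N : ℕ → Fin n → Set
  N = Layer G N₀

  Within : ℕ → Fin n → Set
  Within zero x = N₀ x
  Within (suc k) x = N₀ x ⊎ ∃[ y ] (x ~ y × Within k y)

  N⇒Within : ∀ i → N i x → Within i x
  N⇒Within zero x∈N₀ = x∈N₀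
  N⇒Within (suc zero) ((y , y∈N₀ , x~y) , _) = inj₂ (y , x~y , y∈N₀)
  N⇒Within (suc (suc i)) ((y , y∈N , x~y) , _) = inj₂ (y , x~y , N⇒Within (suc i) y∈N)

  -- Only ¬¬: N₀ is an arbitrary predicate, so layer membership is undecidable.
  Within⇒¬¬N : ∀ k → Within k x → ¬ ¬ (∃[ m ] (m ≤ k × N m x))
  Within⇒¬¬N zero x∈N₀ ¬N = ¬N (0 , z≤n , x∈N₀)
  Within⇒¬¬N (suc k) (inj₁ x∈N₀) ¬N = ¬N (0 , z≤n , x∈N₀)
  Within⇒¬¬N (suc k) (inj₂ (y , x~y , y-within)) ¬N = Within⇒¬¬N k y-within λ where
    (zero , _ , y∈N₀) →
      ¬N (1 , s≤s z≤n , (y , y∈N₀ , x~y) , λ x∈N₀ → ¬N (0 , z≤n , x∈N₀))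
    (suc m , 1+m≤k , y∈N) →
      ¬N (2 + m , s≤s 1+m≤k , (y , y∈N , x~y) ,
          (λ x∈N → ¬N (suc m , m≤n⇒m≤1+n 1+m≤k , x∈N)) ,
          (λ x∈N → ¬N (m , ≤-trans (n≤1+n m) (m≤n⇒m≤1+n 1+m≤k) , x∈N)))

  -- N (2 + m) excludes only N (1 + m) and N m by definition; x ∈ N i with i < m is excluded
  -- because its neighbour y ∈ N (1 + m) would then be within distance i + 1 of N₀.
  N-disjoint-step : ∀ m → (∀ {i y} → i < suc m → N i y → ¬ N (suc m) y) →
                    ∀ {i x} → i < 2 + m → N i x → ¬ N (2 + m) x
  N-disjoint-step m N₁₊ₘ-disjoint {i} {x} i<2+m x∈Nᵢ ((y , y∈N₁₊ₘ , x~y) , x∉N₁₊ₘ , x∉Nₘ)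
    with m≤n⇒m<n∨m≡n (≤-pred i<2+m)
  ... | inj₂ i≡1+m = x∉N₁₊ₘ (subst (λ k → N k x) i≡1+m x∈Nᵢ)
  ... | inj₁ i<1+m with m≤n⇒m<n∨m≡n (≤-pred i<1+m)
  ...   | inj₂ i≡m = x∉Nₘ (subst (λ k → N k x) i≡m x∈Nᵢ)
  ...   | inj₁ i<m = Within⇒¬¬N (suc i) (inj₂ (x , ~-sym x~y , N⇒Within i x∈Nᵢ))
    λ (m' , m'≤1+i , y∈Nₘ') → N₁₊ₘ-disjoint (s≤s (≤-trans m'≤1+i i<m)) y∈Nₘ' y∈N₁₊ₘ

  N-disjoint : ∀ m {i x} → i < m → N i x → ¬ N m x
  N-disjoint (suc zero) (s≤s z≤n) x∈N₀ (_ , x∉N₀) = x∉N₀ x∈N₀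
  N-disjoint (suc (suc m)) = N-disjoint-step m (N-disjoint (suc m))

  N-minimal : N i x → Within k x → i ≤ k
  N-minimal {i} {k = k} x∈Nᵢ x-within with i ≤? k
  ... | yes i≤k = i≤k
  ... | no i≰k = ⊥-elim (Within⇒¬¬N k x-within λ (m , m≤k , x∈Nₘ) →
                   N-disjoint i (≤-<-trans m≤k (≰⇒> i≰k)) x∈Nₘ x∈Nᵢ)

  N-edge : N i x → N j y → x ~ y → j ≤ suc i
  N-edge {i} x∈Nᵢ y∈Nⱼ x~y = N-minimal y∈Nⱼ (inj₂ (_ , ~-sym x~y , N⇒Within i x∈Nᵢ))

  N≥3⇒Far : N₀ v → 3 ≤ i → N i u → Far u v
  N≥3⇒Far {v} {i} {u} v∈N₀ 3≤i u∈Nᵢ = record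
    { distinct            = λ { refl → near (inj₁ v∈N₀) }
    ; nonadjacent         = λ u~v → near (inj₂ (v , u~v , inj₁ v∈N₀))
    ; no-common-neighbour = λ u~z z~v → near (inj₂ (_ , u~z , inj₂ (v , z~v , v∈N₀)))
    }
    where
    near : Within 2 u → ⊥
    near u-within with ≤-trans 3≤i (N-minimal {k = 2} u∈Nᵢ u-within)
    ... | s≤s (s≤s ())

  N≥3-neighbour∈N₂ : N₀ v → 3 ≤ i → N i u → u ~ x → N j x → ¬ Far x v → N 2 x
  N≥3-neighbour∈N₂ {x = x} {j = j} v∈N₀ 3≤i u∈Nᵢ u~x x∈Nⱼ x-near with 3 ≤? j
  ... | yes 3≤j = ⊥-elim (x-near (N≥3⇒Far v∈N₀ 3≤j x∈Nⱼ))
  ... | no 3≰j = subst (λ k → N k x) j≡2 x∈Nⱼ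
    where
    j≡2 : j ≡ 2
    j≡2 = ≤-antisym (≤-pred (≰⇒> 3≰j)) (≤-pred (≤-trans 3≤i (N-edge x∈Nⱼ u∈Nᵢ (~-sym u~x))))

module K33Free {n : ℕ} (G : Graph n) (noK33 : ¬ HasK33 (Graph._~_ G)) where
  open Graph G
  open GraphFacts G

  private variable
    a b c a' b' c' p q p' q' u w x y y' : Fin n

  -- The six disequalities between adjacent vertices are left out.
  no-K33 : a ~ b → b ~ c → a ~ c → a ~ a' → b ~ b' → c ~ c' →
           a ≢ b' → a ≢ c' → b ≢ a' → b ≢ c' → c ≢ a' → c ≢ b' → a' ≢ b' → a' ≢ c' → b' ≢ c' → ⊥
  no-K33 a~b b~c a~c a~a' b~b' c~c' a≢b' a≢c' b≢a' b≢c' c≢a' c≢b' a'≢b' a'≢c' b'≢c' =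
    noK33 (_ , _ , _ , _ , _ , _ ,
           (~⇒≢ a~b , ~⇒≢ a~c , ~⇒≢ a~a' , a≢b' , a≢c' , ~⇒≢ b~c , b≢a' , ~⇒≢ b~b' , b≢c' ,
            c≢a' , c≢b' , ~⇒≢ c~c' , a'≢b' , a'≢c' , b'≢c') ,
           (a~b , b~c , a~c , a~a' , b~b' , c~c'))

  K23-nbhd : K23 x p q p' q' → NbhdIn x (p ∷ q ∷ p' ∷ q' ∷ [])
  K23-nbhd (k23 x~p x~q p~q p~p' q~q' x≢p' x≢q' p≢q' q≢p' p'≢q') =
    nbhdIn λ { x~w (w≢p ∷ w≢q ∷ w≢p' ∷ w≢q' ∷ []) →
      no-K33 x~p p~q x~q x~w p~p' q~q'
        x≢p' x≢q' (≢-sym w≢p) p≢q' (≢-sym w≢q) q≢p' w≢p' w≢q' p'≢q' }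

  K23-edge-in-triangle : K23 x p q p' q' → x ~ w → ∃[ w' ] (x ~ w' × w' ≢ w × w ~ w')
  K23-edge-in-triangle t@(k23 x~p x~q p~q p~p' q~q' _ _ _ _ _) x~w with K23-nbhd t x~w
  ... | here refl                         = _ , x~q , ≢-sym (~⇒≢ p~q) , p~q
  ... | there (here refl)                 = _ , x~p , ~⇒≢ p~q , ~-sym p~q
  ... | there (there (here refl))         = _ , x~p , ~⇒≢ p~p' , ~-sym p~p'
  ... | there (there (there (here refl))) = _ , x~q , ~⇒≢ q~q' , ~-sym q~q'

  five-vertex-closed : K23 u b c b' c' → NbhdIn u (b ∷ c ∷ []) → K23 b c y u y' →
                       Closed (u ∷ b ∷ c ∷ y ∷ y' ∷ [])
  five-vertex-closed {u} {b} {c} {b'} {c'} {y} {y'}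
    (k23 u~b u~c _ b~b' c~c' u≢b' u≢c' b≢c' c≢b' b'≢c') N[u]
    s@(k23 b~c b~y c~y c~u y~y' b≢u b≢y' c≢y' y≢u u≢y') = closed
    where
    N[b] : NbhdIn b (c ∷ y ∷ u ∷ y' ∷ [])
    N[b] = K23-nbhd s

    N[c] : NbhdIn c (u ∷ b ∷ c ∷ y ∷ y' ∷ [])
    N[c] = nbhdIn λ { c~r (r≢u ∷ r≢b ∷ _ ∷ r≢y ∷ r≢y' ∷ []) →
      no-K33 b~c c~y b~y (~-sym u~b) c~r y~y'
        (≢-sym r≢b) b≢y' (~⇒≢ c~u) c≢y' y≢u (≢-sym r≢y) (≢-sym r≢u) u≢y' r≢y' }

    -- b' and c' are y and y' in some order.
    y'-attached : b ~ y' ⊎ c ~ y'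
    y'-attached with N[b] b~b' | N[c] c~c'
    ... | here refl | _ = ⊥-elim (c≢b' refl)
    ... | there (there (here refl)) | _ = ⊥-elim (u≢b' refl)
    ... | there (there (there (here refl))) | _ = inj₁ b~b'
    ... | _ | here refl = ⊥-elim (u≢c' refl)
    ... | _ | there (here refl) = ⊥-elim (b≢c' refl)
    ... | _ | there (there (here refl)) = ⊥-elim (~⇒≢ c~c' refl)
    ... | _ | there (there (there (there (here refl)))) = inj₂ c~c'
    ... | there (here refl) | there (there (there (here refl))) = ⊥-elim (b'≢c' refl)

    N[y] : NbhdIn y (u ∷ b ∷ c ∷ y ∷ y' ∷ [])
    N[y] = nbhdIn λ { y~r (r≢u ∷ r≢b ∷ r≢c ∷ _ ∷ r≢y' ∷ []) → case y'-attached of λ where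
      (inj₁ b~y') → no-K33 b~c c~y b~y b~y' c~u y~r
        b≢u (≢-sym r≢b) c≢y' (≢-sym r≢c) (~⇒≢ y~y') y≢u (≢-sym u≢y') (≢-sym r≢y') (≢-sym r≢u)
      (inj₂ c~y') → no-K33 b~c c~y b~y (~-sym u~b) c~y' y~r
        b≢y' (≢-sym r≢b) (~⇒≢ c~u) (≢-sym r≢c) y≢u (~⇒≢ y~y') u≢y' (≢-sym r≢u) (≢-sym r≢y') }

    N[y'] : NbhdIn y' (u ∷ b ∷ c ∷ y ∷ y' ∷ [])
    N[y'] = nbhdIn λ { y'~r (r≢u ∷ r≢b ∷ r≢c ∷ r≢y ∷ _ ∷ []) → case y'-attached of λ where
      (inj₁ b~y') → no-K33 b~y y~y' b~y' (~-sym u~b) (~-sym c~y) y'~r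
        (~⇒≢ b~c) (≢-sym r≢b) y≢u (≢-sym r≢y) (≢-sym u≢y') (≢-sym c≢y') (≢-sym (~⇒≢ c~u)) (≢-sym r≢u) (≢-sym r≢c)
      (inj₂ c~y') → no-K33 c~y y~y' c~y' c~u (~-sym b~y) y'~r
        (≢-sym (~⇒≢ b~c)) (≢-sym r≢c) y≢u (≢-sym r≢y) (≢-sym u≢y') (≢-sym b≢y') (~⇒≢ u~b) (≢-sym r≢u) (≢-sym r≢b) }

    closed : Closed (u ∷ b ∷ c ∷ y ∷ y' ∷ [])
    closed (here refl) = nbhdIn λ { u~r (_ ∷ r≢b ∷ r≢c ∷ _) → All¬⇒¬Any (r≢b ∷ r≢c ∷ []) (N[u] u~r) }
    closed (there (here refl)) = nbhdIn λ { b~r (r≢u ∷ _ ∷ r≢c ∷ r≢y ∷ r≢y' ∷ []) →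
      All¬⇒¬Any (r≢c ∷ r≢y ∷ r≢u ∷ r≢y' ∷ []) (N[b] b~r) }
    closed (there (there (here refl))) = N[c]
    closed (there (there (there (here refl)))) = N[y]
    closed (there (there (there (there (here refl))))) = N[y']

  module _ (v : Fin n) (v∉K23 : ¬ InK23Triangle _~_ v)
           (sat : ∀ x y → x ≢ y → ¬ x ~ y → HasK33 (AddEdge _~_ x y)) where

    module _ {u : Fin n} (far : Far u v) where
      open Far far

      infix 4 _~⁺_
      _~⁺_ : Fin n → Fin n → Set
      _~⁺_ = AddEdge _~_ u v

      ~⁺-sym : x ~⁺ y → y ~⁺ x
      ~⁺-sym (inj₁ x~y) = inj₁ (~-sym x~y)
      ~⁺-sym (inj₂ (inj₁ (x≡u , y≡v))) = inj₂ (inj₂ (y≡v , x≡u))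
      ~⁺-sym (inj₂ (inj₂ (x≡v , y≡u))) = inj₂ (inj₁ (y≡u , x≡v))

      ~⁺-old : x ~⁺ y → x ≢ u → x ≢ v → x ~ y
      ~⁺-old (inj₁ x~y) _ _ = x~y
      ~⁺-old (inj₂ (inj₁ (x≡u , _))) x≢u _ = ⊥-elim (x≢u x≡u)
      ~⁺-old (inj₂ (inj₂ (x≡v , _))) _ x≢v = ⊥-elim (x≢v x≡v)

      no-common-neighbour⁺ : u ~⁺ a → v ~⁺ a → u ≢ a → v ≢ a → ⊥
      no-common-neighbour⁺ {a} u~a v~a u≢a v≢a = no-common-neighbour (~-sym (old u~a)) (old v~a)
        where
        old : x ~⁺ a → a ~ x
        old x~a = ~⁺-old (~⁺-sym x~a) (≢-sym u≢a) (≢-sym v≢a)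

      triangle-edge-old : x ~⁺ y → y ~⁺ a → x ~⁺ a → x ≢ a → y ≢ a → x ~ y
      triangle-edge-old (inj₁ x~y) _ _ _ _ = x~y
      triangle-edge-old (inj₂ (inj₁ (refl , refl))) v~a u~a u≢a v≢a = ⊥-elim (no-common-neighbour⁺ u~a v~a u≢a v≢a)
      triangle-edge-old (inj₂ (inj₂ (refl , refl))) u~a v~a v≢a u≢a = ⊥-elim (no-common-neighbour⁺ u~a v~a u≢a v≢a)

      new-pendant⇒K23 : a ~ b → b ~ c → a ~ c → b ~⁺ b' → c ~⁺ c' →
                        (a ≡ u × a' ≡ v) ⊎ (a ≡ v × a' ≡ u) →
                        b ≢ a' → c ≢ a' → a ≢ b' → a ≢ c' → b ≢ c' → c ≢ b' → b' ≢ c' → K23 u b c b' c'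
      new-pendant⇒K23 a~b b~c a~c b~⁺b' c~⁺c' (inj₁ (refl , refl)) b≢v c≢v u≢b' u≢c' b≢c' c≢b' b'≢c' =
        k23 a~b a~c b~c (~⁺-old b~⁺b' (≢-sym (~⇒≢ a~b)) b≢v) (~⁺-old c~⁺c' (≢-sym (~⇒≢ a~c)) c≢v)
            u≢b' u≢c' b≢c' c≢b' b'≢c'
      new-pendant⇒K23 a~b b~c a~c b~⁺b' c~⁺c' (inj₂ (refl , refl)) b≢u c≢u v≢b' v≢c' b≢c' c≢b' b'≢c' =
        ⊥-elim (v∉K23 (K23⇒InK23Triangle
          (k23 a~b a~c b~c (~⁺-old b~⁺b' b≢u (≢-sym (~⇒≢ a~b))) (~⁺-old c~⁺c' c≢u (≢-sym (~⇒≢ a~c)))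
               v≢b' v≢c' b≢c' c≢b' b'≢c')))

      far⇒K23 : ∃[ p ] ∃[ q ] ∃[ p' ] ∃[ q' ] K23 u p q p' q'
      far⇒K23 with sat u v distinct nonadjacent
      ... | a , b , c , a' , b' , c' ,
            (a≢b , a≢c , a≢a' , a≢b' , a≢c' , b≢c , b≢a' , b≢b' , b≢c' , c≢a' , c≢b' , c≢c' , a'≢b' , a'≢c' , b'≢c') ,
            (a~⁺b , b~⁺c , a~⁺c , a~⁺a' , b~⁺b' , c~⁺c') = pendants a~⁺a' b~⁺b' c~⁺c'
        where
        a~b : a ~ b
        a~b = triangle-edge-old a~⁺b b~⁺c a~⁺c a≢c b≢c
        b~c : b ~ c
        b~c = triangle-edge-old b~⁺c (~⁺-sym a~⁺c) (~⁺-sym a~⁺b) (≢-sym a≢b) (≢-sym a≢c)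
        a~c : a ~ c
        a~c = triangle-edge-old a~⁺c (~⁺-sym b~⁺c) a~⁺b a≢b (≢-sym b≢c)
        pendants : a ~⁺ a' → b ~⁺ b' → c ~⁺ c' → ∃[ p ] ∃[ q ] ∃[ p' ] ∃[ q' ] K23 u p q p' q'
        pendants (inj₂ new) b~⁺b' c~⁺c' = _ , _ , _ , _ ,
          new-pendant⇒K23 a~b b~c a~c b~⁺b' c~⁺c' new b≢a' c≢a' a≢b' a≢c' b≢c' c≢b' b'≢c'
        pendants (inj₁ a~a') (inj₂ new) c~⁺c' = _ , _ , _ , _ ,
          new-pendant⇒K23 (~-sym a~b) a~c b~c (inj₁ a~a') c~⁺c' new
            a≢b' c≢b' b≢a' b≢c' a≢c' c≢a' a'≢c'
        pendants (inj₁ a~a') (inj₁ b~b') (inj₂ new) = _ , _ , _ , _ ,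
          new-pendant⇒K23 (~-sym a~c) a~b (~-sym b~c) (inj₁ a~a') (inj₁ b~b') new
            a≢c' b≢c' c≢a' c≢b' a≢b' b≢a' a'≢b'
        pendants (inj₁ a~a') (inj₁ b~b') (inj₁ c~c') = ⊥-elim
          (no-K33 a~b b~c a~c a~a' b~b' c~c' a≢b' a≢c' b≢a' b≢c' c≢a' c≢b' a'≢b' a'≢c' b'≢c')

    -- If b were far, u would be the pendant at c of a K²₃ at b, and these five vertices
    -- would form a component missing v.
    apex-neighbour-not-far : Connected G → K23 u b c b' c' → NbhdIn u (b ∷ c ∷ []) → ¬ Far b v
    apex-neighbour-not-far {u} {b} {c} conn t@(k23 u~b _ _ _ _ _ _ _ _ _) N[u] far-b = not-far (far⇒K23 far-b)
      where
      open Far far-b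

      u-in-triangle : K23 b u q p' q' → ⊥
      u-in-triangle (k23 _ b~q u~q u~p' _ b≢p' _ _ q≢p' _) with N[u] u~q | N[u] u~p'
      ... | here refl | _ = ~⇒≢ b~q refl
      ... | _ | here refl = b≢p' refl
      ... | there (here refl) | there (here refl) = q≢p' refl

      u-pendant : K23 b p q u q' → ⊥
      u-pendant s@(k23 b~p b~q _ p~u q~q' _ _ _ _ _) with N[u] (~-sym p~u)
      ... | here refl = ~⇒≢ b~p refl
      ... | there (here refl)
          with closed-reachable (five-vertex-closed t N[u] s) (conn b v) (there (here refl))
      ...   | here refl = nonadjacent (~-sym u~b)
      ...   | there (here refl) = distinct refl
      ...   | there (there (here refl)) = nonadjacent b~p
      ...   | there (there (there (here refl))) = nonadjacent b~q
      ...   | there (there (there (there (here refl)))) = no-common-neighbour b~q q~q'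

      not-far : ∃[ p ] ∃[ q ] ∃[ p' ] ∃[ q' ] K23 b p q p' q' → ⊥
      not-far (_ , _ , _ , _ , s) with K23-nbhd s (~-sym u~b)
      ... | here refl                         = u-in-triangle s
      ... | there (here refl)                 = u-in-triangle (K23-swap s)
      ... | there (there (here refl))         = u-pendant s
      ... | there (there (there (here refl))) = u-pendant (K23-swap s)

    deg2-apex-neighbour-not-far : Connected G → deg G u ≡ 2 → K23 u p q p' q' → u ~ w → ¬ Far w v
    deg2-apex-neighbour-not-far conn deg≡2 t@(k23 u~p u~q p~q _ _ _ _ _ _ _) u~w
      with deg≡2⇒nbhd deg≡2 u~p u~q (~⇒≢ p~q) u~w
    ... | here refl = apex-neighbour-not-far conn t (deg≡2⇒nbhd deg≡2 u~p u~q (~⇒≢ p~q))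
    ... | there (here refl) =
      apex-neighbour-not-far conn (K23-swap t) (deg≡2⇒nbhd deg≡2 u~q u~p (≢-sym (~⇒≢ p~q)))

lemma3p3 : (n : ℕ) (G : Graph n) → Connected G → K33Saturated G → n ≥ 6 → MinDeg≥ G 2 →
    (N₀ : Fin n → Set) → (∃[ x ] N₀ x) →
    (d : ℕ) → 3 ≤ d → d ≤ 4 → (∀ x → ∃[ i ] (i ≤ d × Layer G N₀ i x)) →
    (v : Fin n) → N₀ v → ¬ InK23Triangle (Graph._~_ G) v →
    ((u : Fin n) → (∃[ i ] (3 ≤ i × i ≤ d × Layer G N₀ i u)) →
       ∀ w → Graph._~_ G u w → ∃[ w' ] (Graph._~_ G u w' × w' ≢ w × Graph._~_ G w w'))
    ×
    ((u : Fin n) → (∃[ i ] (3 ≤ i × i ≤ d × Layer G N₀ i u)) → deg G u ≡ 2 →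
       Layer G N₀ 3 u × TypeIV G u × (∀ w → Graph._~_ G u w → Layer G N₀ 2 w))
lemma3p3 n G conn (_ , noK33 , sat) _ _ N₀ _ d _ _ cover v v∈N₀ v∉K23 = edge-in-triangle , degree-two
  where
  open Graph G
  open GraphFacts G
  open Layers G N₀
  open K33Free G noK33

  apex : ∀ {i u} → 3 ≤ i → N i u → ∃[ p ] ∃[ q ] ∃[ p' ] ∃[ q' ] K23 u p q p' q'
  apex 3≤i u∈Nᵢ = far⇒K23 v v∉K23 sat (N≥3⇒Far v∈N₀ 3≤i u∈Nᵢ)

  edge-in-triangle : (u : Fin n) → ∃[ i ] (3 ≤ i × i ≤ d × N i u) →
                     ∀ w → u ~ w → ∃[ w' ] (u ~ w' × w' ≢ w × w ~ w')
  edge-in-triangle u (i , 3≤i , _ , u∈Nᵢ) w u~w with apex 3≤i u∈Nᵢ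
  ... | _ , _ , _ , _ , t = K23-edge-in-triangle t u~w

  degree-two : (u : Fin n) → ∃[ i ] (3 ≤ i × i ≤ d × N i u) → deg G u ≡ 2 →
               N 3 u × TypeIV G u × (∀ w → u ~ w → N 2 w)
  degree-two u (i , 3≤i , _ , u∈Nᵢ) deg≡2 with apex 3≤i u∈Nᵢ
  ... | _ , _ , _ , _ , t@(k23 u~p _ _ _ _ _ _ _ _ _) = u∈N₃ , K23⇒TypeIV deg≡2 t , N[u]⊆N₂
    where
    N[u]⊆N₂ : ∀ w → u ~ w → N 2 w
    N[u]⊆N₂ w u~w with cover w
    ... | j , _ , w∈Nⱼ = N≥3-neighbour∈N₂ {j = j} v∈N₀ 3≤i u∈Nᵢ u~w w∈Nⱼ
                           (deg2-apex-neighbour-not-far v v∉K23 sat conn deg≡2 t u~w)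
    u∈N₃ : N 3 u
    u∈N₃ = subst (λ k → N k u) (≤-antisym (N-edge (N[u]⊆N₂ _ u~p) u∈Nᵢ (~-sym u~p)) 3≤i) u∈Nᵢ
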